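{- For all integers $n \ge 2$, \[ p(n) \ge \frac{2^{8\sqrt{n}/3}}{2^{5/2}\, n^{3/4}}. \]
   Context: For a non-negative integer $n$, a partition of $n$ is a weakly decreasing sequence of positive integers whose sum is $n$, and $p(n)$ denotes the number of partitions of $n$. -}

module Defs where

open import Data.Nat using (ℕ; zero; suc; _≤_; _≥_; _≥?_; _≤?_)
open import Data.Nat.Properties using (_≟_)
open import Data.List using (List; []; _∷_; [_]; map; concatMap; upTo; filter; length)
open import Data.Nat.ListAction using (sum)
open import Data.List.Relation.Unary.All using (All; all?)
open import Data.List.Relation.Unary.Linked using (Linked; linked?)
open import Data.Product using (_×_)
open import Relation.Nullary using (Dec)
open import Relation.Nullary.Decidable using (_×-dec_)
open import Relation.Binary.PropositionalEquality using (_≡_)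

IsPartition : ℕ → List ℕ → Set
IsPartition n l = Linked _≥_ l × All (λ x → 1 ≤ x) l × sum l ≡ n

isPartition? : ∀ n l → Dec (IsPartition n l)
isPartition? n l = linked? _≥?_ l ×-dec (all? (1 ≤?_) l ×-dec (sum l ≟ n))

listsOfLength : ℕ → ℕ → List (List ℕ)
listsOfLength m zero = [ [] ]
listsOfLength m (suc k) =
  concatMap (λ x → map (x ∷_) (listsOfLength m k)) (map suc (upTo m))

-- Candidates: all lists of length ≤ n with entries in {1..n}, each listed once.
-- Every partition of n is among them (it has at most n parts, each ≤ n).
candidates : ℕ → List (List ℕ)
candidates n = concatMap (listsOfLength n) (upTo (suc n))

p : ℕ → ℕ
p n = length (filter (isPartition? n) (candidates n))

-- Let p_m(n) be the number of partitions of n into exactly m parts.  The recurrence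
-- p_{k+1}(n + 1) = p_k(n) + p_{k+1}(n − k) (drop a part 1, or lower every part by 1) gives
-- p_{k+1}(n) ≥ (n − k)^k / (k!(k + 1)!).  It suffices to find, for each n ≥ 2, some s ≥ 32√n with
-- 2^s ≤ p(n)^12 · 2^30 · n^9.  For n ≥ 1024 take k + 1 = ⌊√n⌋ and s = 32(k + 2): then
-- p(n) ≥ ((k + 1)k)^k / (k!(k + 1)!), and the inequality, true at k = 31, propagates to all larger k
-- since this bound grows from k to k + 1 by the factor (1 + 2/k)^k ≥ (169/25)(k + 1)/(k + 2), which
-- follows from (1 + 1/b)^b ≥ 13/5 for b ≥ 15, itself read off the first four binomial terms.
-- For 2 ≤ n < 1024 the inequality is checked by evaluation, bounding p(n) below by the sum of
-- the same lower bounds over the number of parts.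

{-# OPTIONS --safe #-}
module Submission where

open import Defs
open import Data.Bool using (Bool; true; false; T; _∧_; if_then_else_)
open import Data.Bool.Properties using (T-∧)
open import Data.Empty using (⊥; ⊥-elim)
open import Data.List using (List; []; _∷_; [_]; map; length; _++_)
open import Data.List.Membership.Propositional using (_∈_)
open import Data.List.Membership.Propositional.Properties
open import Data.List.Properties using (length-++; length-map; ++-cancelʳ; map-injective)
open import Data.List.Relation.Binary.Subset.Propositional using (_⊆_)
open import Data.List.Relation.Unary.All as All using (All; []; _∷_)
import Data.List.Relation.Unary.All.Properties as All
open import Data.List.Relation.Unary.AllPairs using ([]; _∷_)
open import Data.List.Relation.Unary.Any using (here; there)
open import Data.List.Relation.Unary.Linked using (Linked; []; [-]; _∷_)
open import Data.List.Relation.Unary.Unique.Propositional using (Unique)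
import Data.List.Relation.Unary.Unique.Propositional.Properties as Unique
open import Data.Nat
open import Data.Nat.Combinatorics using (_C_; nC1≡n; nCk+nC[k+1]≡[n+1]C[k+1])
open import Data.Nat.DivMod using (_/_; m/n*n≤m)
open import Data.Nat.ListAction using (sum)
open import Data.Nat.ListAction.Properties using (sum-++)
open import Data.Nat.Properties
open import Data.Nat.Solver using (module +-*-Solver)
open +-*-Solver using (solve; _:*_; _:^_; _:=_)
open import Data.Nat.Tactic.RingSolver using (solve-∀)
open import Data.Product using (∃; _×_; _,_; proj₁; proj₂; map₂)
open import Data.Sum using (inj₁; inj₂)
open import Function.Bundles using (Equivalence)
open import Relation.Binary.PropositionalEquality hiding ([_])
open import Relation.Nullary using (¬_; yes; no)

^-distrib-* : ∀ m n k → (m * n) ^ k ≡ m ^ k * n ^ k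
^-distrib-* m n zero = refl
^-distrib-* m n (suc k) = trans (cong (m * n *_) (^-distrib-* m n k)) ([m*n]*[o*p]≡[m*o]*[n*p] m n (m ^ k) (n ^ k))

m*m≤n*n⇒m≤n : ∀ {m n} → m * m ≤ n * n → m ≤ n
m*m≤n*n⇒m≤n m*m≤n*n = ≮⇒≥ (λ n<m → <⇒≱ (*-mono-< n<m n<m) m*m≤n*n)

m≤n*o⇒m/n≤o : ∀ {m n o} .{{_ : NonZero n}} → m ≤ n * o → m / n ≤ o
m≤n*o⇒m/n≤o {m} {n} {o} m≤n*o =
  *-cancelʳ-≤ (m / n) o n (≤-trans (m/n*n≤m m n) (≤-trans m≤n*o (≤-reflexive (*-comm n o))))

^-increment-≤ : ∀ x d j → (x + d) ^ suc j ≤ x ^ suc j + suc j * d * (x + d) ^ j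
^-increment-≤ x d zero = ≤-reflexive (identity x d)
  where
  identity : ∀ x d → (x + d) * 1 ≡ x * 1 + 1 * d * 1
  identity = solve-∀
^-increment-≤ x d (suc j) = begin
  (x + d) * (x + d) ^ suc j                       ≤⟨ *-monoʳ-≤ (x + d) (^-increment-≤ x d j) ⟩
  (x + d) * (x ^ suc j + suc j * d * (x + d) ^ j)  ≡⟨ expand x d (x ^ suc j) (suc j * d * (x + d) ^ j) ⟩
  x ^ suc (suc j) + (d * x ^ suc j + (x + d) * (suc j * d * (x + d) ^ j))
    ≤⟨ +-monoʳ-≤ (x ^ suc (suc j)) (+-monoˡ-≤ _ (*-monoʳ-≤ d (^-monoˡ-≤ (suc j) (m≤m+n x d)))) ⟩
  x ^ suc (suc j) + (d * (x + d) ^ suc j + (x + d) * (suc j * d * (x + d) ^ j))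
    ≡⟨ cong (x ^ suc (suc j) +_) (collect d (x + d) (suc j) ((x + d) ^ j)) ⟩
  x ^ suc (suc j) + suc (suc j) * d * (x + d) ^ suc j ∎
  where
  open ≤-Reasoning
  expand : ∀ x d u v → (x + d) * (u + v) ≡ x * u + (d * u + (x + d) * v)
  expand = solve-∀
  collect : ∀ d y i u → d * (y * u) + y * (i * d * u) ≡ (1 + i) * d * (y * u)
  collect = solve-∀

!*!-suc : ∀ k → suc k ! * suc (suc k) ! ≡ suc k * suc (suc k) * (k ! * suc k !)
!*!-suc k = regroup k (k !)
  where
  regroup : ∀ k f → (suc k * f) * (suc (suc k) * (suc k * f)) ≡ suc k * suc (suc k) * (f * (suc k * f))
  regroup = solve-∀

sumBelow : ℕ → (ℕ → ℕ) → ℕ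
sumBelow zero _ = 0
sumBelow (suc M) f = f M + sumBelow M f

sumBelow-mono-≤ : ∀ M {f g : ℕ → ℕ} → (∀ k → k < M → f k ≤ g k) → sumBelow M f ≤ sumBelow M g
sumBelow-mono-≤ zero _ = z≤n
sumBelow-mono-≤ (suc M) f≤g =
  +-mono-≤ (f≤g M ≤-refl) (sumBelow-mono-≤ M (λ k k<M → f≤g k (m≤n⇒m≤1+n k<M)))

floorSqrt : ∀ n → ∃ λ j → j * j ≤ n × n < suc j * suc j
floorSqrt zero = 0 , z≤n , s≤s z≤n
floorSqrt (suc n) with floorSqrt n
... | j , j²≤n , n<[1+j]² with suc n <? suc j * suc j
...   | yes 1+n<[1+j]² = j , m≤n⇒m≤1+n j²≤n , 1+n<[1+j]²
...   | no 1+n≮[1+j]² = suc j , ≮⇒≥ 1+n≮[1+j]² , ≤-<-trans n<[1+j]² (*-mono-< (n<1+n (suc j)) (n<1+n (suc j)))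

Unique-⊆⇒length≤ : ∀ {A : Set} {xs ys : List A} → Unique xs → xs ⊆ ys → length xs ≤ length ys
Unique-⊆⇒length≤ {xs = []} _ _ = z≤n
Unique-⊆⇒length≤ {xs = x ∷ xs} (x∉xs ∷ uniq) xs⊆ys with ∈-∃++ (xs⊆ys (here refl))
... | ys₁ , ys₂ , refl = begin
  suc (length xs)         ≤⟨ s≤s (Unique-⊆⇒length≤ uniq xs⊆ys₁++ys₂) ⟩
  suc (length (ys₁ ++ ys₂)) ≡⟨ cong suc (length-++ ys₁) ⟩
  suc (length ys₁ + length ys₂) ≡⟨ sym (+-suc (length ys₁) (length ys₂)) ⟩
  length ys₁ + suc (length ys₂) ≡⟨ sym (length-++ ys₁) ⟩
  length (ys₁ ++ x ∷ ys₂) ∎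
  where
  open ≤-Reasoning
  xs⊆ys₁++ys₂ : xs ⊆ ys₁ ++ ys₂
  xs⊆ys₁++ys₂ {y} y∈xs with ∈-++⁻ ys₁ (xs⊆ys (there y∈xs))
  ... | inj₁ y∈ys₁ = ∈-++⁺ˡ y∈ys₁
  ... | inj₂ (here refl) = ⊥-elim (All.lookup x∉xs y∈xs refl)
  ... | inj₂ (there y∈ys₂) = ∈-++⁺ʳ ys₁ y∈ys₂

length≤sum : ∀ {l} → All (1 ≤_) l → length l ≤ sum l
length≤sum [] = z≤n
length≤sum (1≤x ∷ 1≤l) = +-mono-≤ 1≤x (length≤sum 1≤l)

All-≤-sum : ∀ l → All (_≤ sum l) l
All-≤-sum [] = []
All-≤-sum (x ∷ l) = m≤m+n x (sum l) ∷ All.map (λ y≤ → ≤-trans y≤ (m≤n+m (sum l) x)) (All-≤-sum l)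

∈-listsOfLength : ∀ m l → All (λ x → 1 ≤ x × x ≤ m) l → l ∈ listsOfLength m (length l)
∈-listsOfLength m [] [] = here refl
∈-listsOfLength m (suc x ∷ l) ((_ , 1+x≤m) ∷ l∈) =
  ∈-concat⁺′ (∈-map⁺ (suc x ∷_) (∈-listsOfLength m l l∈))
             (∈-map⁺ (λ y → map (y ∷_) (listsOfLength m (length l))) (∈-map⁺ suc (∈-upTo⁺ 1+x≤m)))

∈-candidates : ∀ {n l} → IsPartition n l → l ∈ candidates n
∈-candidates {n} {l} (_ , positive , refl) =
  ∈-concat⁺′ (∈-listsOfLength n l (All.zip (positive , All-≤-sum l)))
             (∈-map⁺ (listsOfLength n) (∈-upTo⁺ (s≤s (length≤sum positive))))

length≤p : ∀ {n ls} → Unique ls → (∀ {l} → l ∈ ls → IsPartition n l) → length ls ≤ p n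
length≤p {n} uniq partition = Unique-⊆⇒length≤ uniq
  (λ l∈ls → ∈-filter⁺ (isPartition? n) (∈-candidates (partition l∈ls)) (partition l∈ls))

Linked-∷ʳ-1 : ∀ {l} → Linked _≥_ l → All (1 ≤_) l → Linked _≥_ (l ++ [ 1 ])
Linked-∷ʳ-1 [] [] = [-]
Linked-∷ʳ-1 [-] (1≤x ∷ []) = 1≤x ∷ [-]
Linked-∷ʳ-1 (x≥y ∷ linked) (_ ∷ positive) = x≥y ∷ Linked-∷ʳ-1 linked positive

Linked-map-suc : ∀ {l} → Linked _≥_ l → Linked _≥_ (map suc l)
Linked-map-suc [] = []
Linked-map-suc [-] = [-]
Linked-map-suc (x≥y ∷ linked) = s≤s x≥y ∷ Linked-map-suc linked

All-map-suc : ∀ l → All (1 ≤_) (map suc l)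
All-map-suc [] = []
All-map-suc (_ ∷ l) = s≤s z≤n ∷ All-map-suc l

sum-map-suc : ∀ l → sum (map suc l) ≡ sum l + length l
sum-map-suc [] = refl
sum-map-suc (x ∷ l) = begin
  suc (x + sum (map suc l))    ≡⟨ cong (λ s → suc (x + s)) (sum-map-suc l) ⟩
  suc (x + (sum l + length l)) ≡⟨ cong suc (sym (+-assoc x (sum l) (length l))) ⟩
  suc (x + sum l + length l)   ≡⟨ sym (+-suc (x + sum l) (length l)) ⟩
  x + sum l + suc (length l)   ∎
  where open ≡-Reasoning

IsPartition-∷ʳ-1 : ∀ {n l} → IsPartition n l → IsPartition (suc n) (l ++ [ 1 ])
IsPartition-∷ʳ-1 {n} {l} (linked , positive , refl) =
  Linked-∷ʳ-1 linked positive , All.++⁺ positive (s≤s z≤n ∷ []) , trans (sum-++ l [ 1 ]) (+-comm (sum l) 1)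

IsPartition-map-suc : ∀ {n l} → IsPartition n l → IsPartition (n + length l) (map suc l)
IsPartition-map-suc {l = l} (linked , _ , refl) = Linked-map-suc linked , All-map-suc l , sum-map-suc l

-- Partitions into a given number of parts

-- The fuel only ensures termination; fuel ≥ n suffices.
partitionsInto : (fuel n m : ℕ) → List (List ℕ)
partitionsInto _ zero zero = [ [] ]
partitionsInto _ zero (suc _) = []
partitionsInto _ (suc _) zero = []
partitionsInto zero (suc n) (suc k) = []
partitionsInto (suc f) (suc n) (suc k) =
  map (_++ [ 1 ]) (partitionsInto f n k) ++ map (map suc) (partitionsInto f (n ∸ k) (suc k))

#partitionsInto : (fuel n m : ℕ) → ℕ
#partitionsInto _ zero zero = 1
#partitionsInto _ zero (suc _) = 0
#partitionsInto _ (suc _) zero = 0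
#partitionsInto zero (suc n) (suc k) = 0
#partitionsInto (suc f) (suc n) (suc k) = #partitionsInto f n k + #partitionsInto f (n ∸ k) (suc k)

length-partitionsInto : ∀ f n m → length (partitionsInto f n m) ≡ #partitionsInto f n m
length-partitionsInto _ zero zero = refl
length-partitionsInto _ zero (suc _) = refl
length-partitionsInto _ (suc _) zero = refl
length-partitionsInto zero (suc n) (suc k) = refl
length-partitionsInto (suc f) (suc n) (suc k) = begin
  length (map (_++ [ 1 ]) ends1 ++ map (map suc) all≥2)   ≡⟨ length-++ (map (_++ [ 1 ]) ends1) ⟩
  length (map (_++ [ 1 ]) ends1) + length (map (map suc) all≥2)
    ≡⟨ cong₂ _+_ (length-map (_++ [ 1 ]) ends1) (length-map (map suc) all≥2) ⟩
  length ends1 + length all≥2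
    ≡⟨ cong₂ _+_ (length-partitionsInto f n k) (length-partitionsInto f (n ∸ k) (suc k)) ⟩
  #partitionsInto f n k + #partitionsInto f (n ∸ k) (suc k) ∎
  where
  open ≡-Reasoning
  ends1 all≥2 : List (List ℕ)
  ends1 = partitionsInto f n k
  all≥2 = partitionsInto f (n ∸ k) (suc k)

partitionsInto-sound : ∀ f n m {l} → l ∈ partitionsInto f n m → IsPartition n l × length l ≡ m
partitionsInto-sound _ zero zero (here refl) = ([] , [] , refl) , refl
partitionsInto-sound (suc f) (suc n) (suc k) l∈ with ∈-++⁻ (map (_++ [ 1 ]) (partitionsInto f n k)) l∈
... | inj₁ l∈ends1 with ∈-map⁻ (_++ [ 1 ]) l∈ends1
...   | l′ , l′∈ , refl with partitionsInto-sound f n k l′∈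
...     | partition , refl = IsPartition-∷ʳ-1 partition , trans (length-++ l′) (+-comm (length l′) 1)
partitionsInto-sound (suc f) (suc n) (suc k) l∈ | inj₂ l∈all≥2 with ∈-map⁻ (map suc) l∈all≥2
... | l′ , l′∈ , refl with partitionsInto-sound f (n ∸ k) (suc k) l′∈
...   | partition@(_ , positive , sum≡) , length≡ =
  subst (λ s → IsPartition s (map suc l′)) n∸k+1+k≡1+n (IsPartition-map-suc partition) ,
  trans (length-map suc l′) length≡
  where
  k<n : k < n
  k<n = m∸n≢0⇒n<m (λ n∸k≡0 → n≮0 (subst₂ _≤_ length≡ (trans sum≡ n∸k≡0) (length≤sum positive)))
  n∸k+1+k≡1+n : n ∸ k + length l′ ≡ suc n
  n∸k+1+k≡1+n = trans (cong (n ∸ k +_) length≡) (trans (+-suc (n ∸ k) k) (cong suc (m∸n+n≡m (<⇒≤ k<n))))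

partitionsInto-unique : ∀ f n m → Unique (partitionsInto f n m)
partitionsInto-unique _ zero zero = [] ∷ []
partitionsInto-unique _ zero (suc _) = []
partitionsInto-unique _ (suc _) zero = []
partitionsInto-unique zero (suc n) (suc k) = []
partitionsInto-unique (suc f) (suc n) (suc k) =
  Unique.++⁺ (Unique.map⁺ (λ {x} {y} → ++-cancelʳ [ 1 ] x y) (partitionsInto-unique f n k))
             (Unique.map⁺ (map-injective suc-injective) (partitionsInto-unique f (n ∸ k) (suc k)))
             disjoint
  where
  disjoint : ∀ {l} →
    l ∈ map (_++ [ 1 ]) (partitionsInto f n k) × l ∈ map (map suc) (partitionsInto f (n ∸ k) (suc k)) → ⊥
  disjoint (l∈ends1 , l∈all≥2) with ∈-map⁻ (_++ [ 1 ]) l∈ends1 | ∈-map⁻ (map suc) l∈all≥2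
  ... | l , _ , refl | l′ , l′∈ , l++1≡ with ∈-map⁻ suc (subst (1 ∈_) l++1≡ (∈-++⁺ʳ l (here refl)))
  ...   | x , x∈l′ , 1≡1+x with partitionsInto-sound f (n ∸ k) (suc k) l′∈
  ...     | (_ , positive , _) , _ = n≮0 (subst (1 ≤_) (suc-injective (sym 1≡1+x)) (All.lookup positive x∈l′))

#partitionsInto≤p : ∀ n m → #partitionsInto n n m ≤ p n
#partitionsInto≤p n m = subst (_≤ p n) (length-partitionsInto n n m)
  (length≤p (partitionsInto-unique n n m) (λ l∈ → proj₁ (partitionsInto-sound n n m l∈)))

sum-#partitionsInto≤p : ∀ n M → sumBelow M (λ k → #partitionsInto n n (suc k)) ≤ p n
sum-#partitionsInto≤p n M = subst (_≤ p n) (length-ls M) (length≤p (unique M) (λ l∈ → proj₁ (sound M l∈)))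
  where
  ls : ℕ → List (List ℕ)
  ls zero = []
  ls (suc M) = partitionsInto n n (suc M) ++ ls M

  length-ls : ∀ M → length (ls M) ≡ sumBelow M (λ k → #partitionsInto n n (suc k))
  length-ls zero = refl
  length-ls (suc M) = trans (length-++ (partitionsInto n n (suc M)))
    (cong₂ _+_ (length-partitionsInto n n (suc M)) (length-ls M))

  sound : ∀ M {l} → l ∈ ls M → IsPartition n l × length l ≤ M
  sound (suc M) l∈ with ∈-++⁻ (partitionsInto n n (suc M)) l∈
  ... | inj₁ l∈′ = map₂ ≤-reflexive (partitionsInto-sound n n (suc M) l∈′)
  ... | inj₂ l∈′ = map₂ m≤n⇒m≤1+n (sound M l∈′)

  unique : ∀ M → Unique (ls M)
  unique zero = []
  unique (suc M) = Unique.++⁺ (partitionsInto-unique n n (suc M)) (unique M) disjoint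
    where
    disjoint : ∀ {l} → l ∈ partitionsInto n n (suc M) × l ∈ ls M → ⊥
    disjoint (l∈ , l∈′) =
      1+n≰n (subst (_≤ M) (proj₂ (partitionsInto-sound n n (suc M) l∈)) (proj₂ (sound M l∈′)))

#partitionsInto-single : ∀ f N → suc N ≤ f → 1 ≤ #partitionsInto f (suc N) 1
#partitionsInto-single (suc f) zero _ = s≤s z≤n
#partitionsInto-single (suc f) (suc N) (s≤s N<f) = #partitionsInto-single f N N<f

-- Induction along the recurrence: the first summand covers N ≤ k + 1, and otherwise
-- ^-increment-≤ splits (N + 1)^(k+1) between the two summands.
#partitionsInto-lowerBound : ∀ f N k → suc (N + k) ≤ f →
  suc N ^ k ≤ k ! * suc k ! * #partitionsInto f (suc (N + k)) (suc k)
#partitionsInto-lowerBound f N zero N<f =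
  subst (1 ≤_) (sym (*-identityˡ _)) (#partitionsInto-single f (N + 0) N<f)
#partitionsInto-lowerBound (suc f) N (suc k) N+k+1<f =
  subst₂ (λ F′ c → suc N ^ suc k ≤ F′ * c) (sym (!*!-suc k)) (sym recurrence) bound
  where
  open ≤-Reasoning
  a F c₁ c₂ : ℕ
  a = suc k * suc (suc k)
  F = k ! * suc k !
  c₁ = #partitionsInto f (suc (N + k)) (suc k)
  c₂ = #partitionsInto f N (suc (suc k))
  recurrence : #partitionsInto (suc f) (suc (N + suc k)) (suc (suc k)) ≡ c₁ + c₂
  recurrence = cong₂ _+_ (cong (λ n → #partitionsInto f n (suc k)) (+-suc N k))
                         (cong (λ n → #partitionsInto f n (suc (suc k))) (m+n∸n≡m N (suc k)))
  N+k<f : suc (N + k) ≤ f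
  N+k<f = ≤-pred (subst (_< suc f) (+-suc N k) N+k+1<f)
  IH₁ : suc N ^ k ≤ F * c₁
  IH₁ = #partitionsInto-lowerBound f N k N+k<f
  bound : suc N ^ suc k ≤ a * F * (c₁ + c₂)
  bound with N ≤? suc k
  ... | yes N≤1+k = begin
    suc N * suc N ^ k   ≤⟨ *-monoˡ-≤ (suc N ^ k) (≤-trans (s≤s N≤1+k) (m≤n*m (suc (suc k)) (suc k))) ⟩
    a * suc N ^ k       ≤⟨ *-monoʳ-≤ a IH₁ ⟩
    a * (F * c₁)        ≡⟨ sym (*-assoc a F c₁) ⟩
    a * F * c₁          ≤⟨ *-monoʳ-≤ (a * F) (m≤m+n c₁ c₂) ⟩
    a * F * (c₁ + c₂)   ∎
  ... | no N≰1+k with m≤n⇒∃[o]m+o≡n (≰⇒> N≰1+k)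
  ...   | o , refl = begin
    suc N ^ suc k                                  ≡⟨ cong (_^ suc k) (sym 1+N≡) ⟩
    (suc o + suc (suc k)) ^ suc k                  ≤⟨ ^-increment-≤ (suc o) (suc (suc k)) k ⟩
    suc o ^ suc k + a * (suc o + suc (suc k)) ^ k  ≡⟨ cong (λ m → suc o ^ suc k + a * m ^ k) 1+N≡ ⟩
    suc o ^ suc k + a * suc N ^ k                  ≤⟨ +-mono-≤ IH₂ (*-monoʳ-≤ a IH₁) ⟩
    a * F * c₂ + a * (F * c₁)                      ≡⟨ collect a F c₁ c₂ ⟩
    a * F * (c₁ + c₂)                              ∎
    where
    1+N≡ : suc o + suc (suc k) ≡ suc N
    1+N≡ = cong suc (+-comm o (suc (suc k)))
    o+k+1≡N : suc (o + suc k) ≡ N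
    o+k+1≡N = trans (sym (+-suc o (suc k))) (+-comm o (suc (suc k)))
    IH₂ : suc o ^ suc k ≤ a * F * c₂
    IH₂ = subst₂ (λ F′ n → suc o ^ suc k ≤ F′ * #partitionsInto f n (suc (suc k))) (!*!-suc k) o+k+1≡N
      (#partitionsInto-lowerBound f o (suc k) (≤-trans (≤-reflexive o+k+1≡N) (≤-trans (m≤m+n N k) (<⇒≤ N+k<f))))
    collect : ∀ a F c₁ c₂ → a * F * c₂ + a * (F * c₁) ≡ a * F * (c₁ + c₂)
    collect = solve-∀

[n∸k]^k≤k!*[1+k]!*#partitionsInto : ∀ {n k} → k < n → (n ∸ k) ^ k ≤ k ! * suc k ! * #partitionsInto n n (suc k)
[n∸k]^k≤k!*[1+k]!*#partitionsInto {n} {k} k<n =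
  subst₂ (λ m n′ → m ^ k ≤ k ! * suc k ! * #partitionsInto n n′ (suc k)) n∸k≡ n≡
    (#partitionsInto-lowerBound n N k (≤-reflexive n≡))
  where
  N : ℕ
  N = n ∸ suc k
  n≡ : suc (N + k) ≡ n
  n≡ = trans (sym (+-suc N k)) (m∸n+n≡m k<n)
  n∸k≡ : suc N ≡ n ∸ k
  n∸k≡ = trans (sym (m+n∸n≡m (suc N) k)) (cong (_∸ k) n≡)

-- Small n

Admissible : ℕ → ℕ → Set
Admissible n s = 1024 * n ≤ s * s × 2 ^ s ≤ p n ^ 12 * 2 ^ 30 * n ^ 9

-- Counting exactly takes exponential time, so it is only used for n ≤ 8,
-- where the closed-form bound is too weak.
estimate : ℕ → ℕ → ℕ
estimate n k =
  if n ≤ᵇ 8 then #partitionsInto n n (suc k) else ((n ∸ k) ^ k / (k ! * suc k !)) {{k !* suc k !≢0}}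

estimate≤#partitionsInto : ∀ {n k} → k < n → estimate n k ≤ #partitionsInto n n (suc k)
estimate≤#partitionsInto {n} {k} k<n with n ≤ᵇ 8
... | true = ≤-refl
... | false = m≤n*o⇒m/n≤o {{k !* suc k !≢0}} ([n∸k]^k≤k!*[1+k]!*#partitionsInto k<n)

-- The cut-off at 25 parts only saves computation.
estimateSum : ℕ → ℕ
estimateSum n = sumBelow (n ⊓ 25) (estimate n)

estimateSum≤p : ∀ n → estimateSum n ≤ p n
estimateSum≤p n = ≤-trans
  (sumBelow-mono-≤ (n ⊓ 25) (λ k k<n⊓25 → estimate≤#partitionsInto (<-≤-trans k<n⊓25 (m⊓n≤m n 25))))
  (sum-#partitionsInto≤p n (n ⊓ 25))

admissibleᵇ : ℕ → ℕ → Bool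
admissibleᵇ n s = (1024 * n ≤ᵇ s * s) ∧ (2 ^ s ≤ᵇ estimateSum n ^ 12 * 2 ^ 30 * n ^ 9)

admissibleᵇ⇒Admissible : ∀ n s → T (admissibleᵇ n s) → Admissible n s
admissibleᵇ⇒Admissible n s ok with Equivalence.to T-∧ ok
... | square-ok , power-ok = ≤ᵇ⇒≤ _ _ square-ok ,
  ≤-trans (≤ᵇ⇒≤ _ _ power-ok) (*-monoˡ-≤ (n ^ 9) (*-monoˡ-≤ (2 ^ 30) (^-monoˡ-≤ 12 (estimateSum≤p n))))

nextCandidate : (fuel n s : ℕ) → ℕ
nextCandidate zero _ s = s
nextCandidate (suc f) n s = if 1024 * n ≤ᵇ s * s then s else nextCandidate f n (suc s)

-- Candidate exponents only grow with n, so each search resumes from the previous one;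
-- the search merely proposes them and admissibleᵇ verifies each.
checkFrom : (c n s : ℕ) → Bool
checkFrom zero _ _ = true
checkFrom (suc c) n s = admissibleᵇ n (nextCandidate 100 n s) ∧ checkFrom c (suc n) (nextCandidate 100 n s)

checkFrom-sound : ∀ c n s → T (checkFrom c n s) → ∀ {i} → n ≤ i → i < n + c → ∃ (Admissible i)
checkFrom-sound zero n _ _ n≤i i<n+0 = ⊥-elim (<⇒≱ (subst (_ <_) (+-identityʳ n) i<n+0) n≤i)
checkFrom-sound (suc c) n s ok {i} n≤i i<n+1+c with Equivalence.to T-∧ ok | m≤n⇒m<n∨m≡n n≤i
... | here-ok , _ | inj₂ refl = nextCandidate 100 n s , admissibleᵇ⇒Admissible n (nextCandidate 100 n s) here-ok
... | _ , rest-ok | inj₁ n<i =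
  checkFrom-sound c (suc n) (nextCandidate 100 n s) rest-ok n<i (subst (i <_) (+-suc n c) i<n+1+c)

admissible-<1024 : ∀ n → 2 ≤ n → n < 1024 → ∃ (Admissible n)
admissible-<1024 n 2≤n n<1024 = checkFrom-sound 1022 2 0 _ 2≤n n<1024

-- (1 + 1/b)^b ≥ 13/5

[1+n]C2≡nC2+n : ∀ n → suc n C 2 ≡ n C 2 + n
[1+n]C2≡nC2+n n = begin
  suc n C 2         ≡⟨ nCk+nC[k+1]≡[n+1]C[k+1] n 1 ⟨
  n C 1 + n C 2     ≡⟨ cong (_+ n C 2) (nC1≡n n) ⟩
  n + n C 2         ≡⟨ +-comm n (n C 2) ⟩
  n C 2 + n         ∎
  where open ≡-Reasoning

[1+n]C3≡nC3+nC2 : ∀ n → suc n C 3 ≡ n C 3 + n C 2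
[1+n]C3≡nC3+nC2 n = trans (sym (nCk+nC[k+1]≡[n+1]C[k+1] n 2)) (+-comm (n C 2) (n C 3))

truncatedBinomial-≤ : ∀ k b → b ^ k * (b * b * b + k * (b * b) + (k C 2) * b + k C 3) ≤ suc b ^ k * (b * b * b)
truncatedBinomial-≤ zero b = ≤-reflexive (identity b)
  where
  identity : ∀ b → 1 * (b * b * b + 0 * (b * b) + 0 * b + 0) ≡ 1 * (b * b * b)
  identity = solve-∀
truncatedBinomial-≤ (suc k) b = begin
  b * b ^ k * (b * b * b + suc k * (b * b) + (suc k C 2) * b + suc k C 3)
    ≡⟨ cong₂ (λ c₂ c₃ → b * b ^ k * (b * b * b + suc k * (b * b) + c₂ * b + c₃))
             ([1+n]C2≡nC2+n k) ([1+n]C3≡nC3+nC2 k) ⟩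
  b * b ^ k * (b * b * b + suc k * (b * b) + (k C 2 + k) * b + (k C 3 + k C 2))
    ≤⟨ m≤m+n _ ((k C 3) * b ^ k) ⟩
  b * b ^ k * (b * b * b + suc k * (b * b) + (k C 2 + k) * b + (k C 3 + k C 2)) + (k C 3) * b ^ k
    ≡⟨ regroup b (b ^ k) k (k C 2) (k C 3) ⟩
  suc b * (b ^ k * (b * b * b + k * (b * b) + (k C 2) * b + k C 3))
    ≤⟨ *-monoʳ-≤ (suc b) (truncatedBinomial-≤ k b) ⟩
  suc b * (suc b ^ k * (b * b * b))
    ≡⟨ *-assoc (suc b) (suc b ^ k) (b * b * b) ⟨
  suc b * suc b ^ k * (b * b * b) ∎
  where
  open ≤-Reasoning
  regroup : ∀ b u k c₂ c₃ → b * u * (b * b * b + (1 + k) * (b * b) + (c₂ + k) * b + (c₃ + c₂)) + c₃ * u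
                          ≡ (1 + b) * (u * (b * b * b + k * (b * b) + c₂ * b + c₃))
  regroup = solve-∀

2*nC2+n≡n*n : ∀ n → 2 * (n C 2) + n ≡ n * n
2*nC2+n≡n*n zero = refl
2*nC2+n≡n*n (suc n) = begin
  2 * (suc n C 2) + suc n         ≡⟨ cong (λ c → 2 * c + suc n) ([1+n]C2≡nC2+n n) ⟩
  2 * (n C 2 + n) + suc n         ≡⟨ regroup (n C 2) n ⟩
  (2 * (n C 2) + n) + (2 * n + 1) ≡⟨ cong (_+ (2 * n + 1)) (2*nC2+n≡n*n n) ⟩
  n * n + (2 * n + 1)             ≡⟨ square n ⟩
  suc n * suc n                   ∎
  where
  open ≡-Reasoning
  regroup : ∀ c n → 2 * (c + n) + suc n ≡ (2 * c + n) + (2 * n + 1)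
  regroup = solve-∀
  square : ∀ n → n * n + (2 * n + 1) ≡ suc n * suc n
  square = solve-∀

6*nC3+3*n*n≡n*n*n+2*n : ∀ n → 6 * (n C 3) + 3 * (n * n) ≡ n * n * n + 2 * n
6*nC3+3*n*n≡n*n*n+2*n zero = refl
6*nC3+3*n*n≡n*n*n+2*n (suc n) = begin
  6 * (suc n C 3) + 3 * (suc n * suc n)
    ≡⟨ cong (λ c → 6 * c + 3 * (suc n * suc n)) ([1+n]C3≡nC3+nC2 n) ⟩
  6 * (n C 3 + n C 2) + 3 * (suc n * suc n)
    ≡⟨ regroup (n C 3) (n C 2) n ⟩
  (6 * (n C 3) + 3 * (n * n)) + 3 * (2 * (n C 2) + n) + (3 * n + 3)
    ≡⟨ cong₂ (λ u v → u + 3 * v + (3 * n + 3)) (6*nC3+3*n*n≡n*n*n+2*n n) (2*nC2+n≡n*n n) ⟩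
  (n * n * n + 2 * n) + 3 * (n * n) + (3 * n + 3)
    ≡⟨ cube n ⟩
  suc n * suc n * suc n + 2 * suc n ∎
  where
  open ≡-Reasoning
  regroup : ∀ c₃ c₂ n → 6 * (c₃ + c₂) + 3 * (suc n * suc n)
                      ≡ (6 * c₃ + 3 * (n * n)) + 3 * (2 * c₂ + n) + (3 * n + 3)
  regroup = solve-∀
  cube : ∀ n → (n * n * n + 2 * n) + 3 * (n * n) + (3 * n + 3) ≡ suc n * suc n * suc n + 2 * suc n
  cube = solve-∀

-- Times 6 this reads 78·b³ ≤ 80·b³ − 30·b² + 10·b, and 30·b² ≤ 2·b³ because b ≥ 15.
cubic-≤ : ∀ b → 15 ≤ b → 13 * (b * b * b) ≤ 5 * (b * b * b + b * (b * b) + (b C 2) * b + b C 3)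
cubic-≤ b 15≤b = *-cancelˡ-≤ 6 (+-cancelʳ-≤ (30 * (b * b)) _ _ (begin
  6 * (13 * (b * b * b)) + 30 * (b * b)         ≤⟨ +-monoʳ-≤ (6 * (13 * (b * b * b))) 30b²≤2b³ ⟩
  6 * (13 * (b * b * b)) + 2 * (b * b * b)      ≤⟨ m≤m+n _ (10 * b) ⟩
  6 * (13 * (b * b * b)) + 2 * (b * b * b) + 10 * b
    ≡⟨ expand b ⟩
  60 * (b * b * b) + 15 * ((b * b) * b) + 5 * (b * b * b + 2 * b)
    ≡⟨ cong₂ (λ u v → 60 * (b * b * b) + 15 * (u * b) + 5 * v) (2*nC2+n≡n*n b) (6*nC3+3*n*n≡n*n*n+2*n b) ⟨
  60 * (b * b * b) + 15 * ((2 * (b C 2) + b) * b) + 5 * (6 * (b C 3) + 3 * (b * b))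
    ≡⟨ collect b (b C 2) (b C 3) ⟩
  6 * (5 * (b * b * b + b * (b * b) + (b C 2) * b + b C 3)) + 30 * (b * b) ∎))
  where
  open ≤-Reasoning
  30b²≤2b³ : 30 * (b * b) ≤ 2 * (b * b * b)
  30b²≤2b³ = begin
    30 * (b * b)        ≡⟨ *-assoc 2 15 (b * b) ⟩
    2 * (15 * (b * b))  ≤⟨ *-monoʳ-≤ 2 (*-monoˡ-≤ (b * b) 15≤b) ⟩
    2 * (b * (b * b))   ≡⟨ cong (2 *_) (*-assoc b b b) ⟨
    2 * (b * b * b)     ∎
  expand : ∀ b → 6 * (13 * (b * b * b)) + 2 * (b * b * b) + 10 * b
               ≡ 60 * (b * b * b) + 15 * ((b * b) * b) + 5 * (b * b * b + 2 * b)
  expand = solve-∀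
  collect : ∀ b c₂ c₃ → 60 * (b * b * b) + 15 * ((2 * c₂ + b) * b) + 5 * (6 * c₃ + 3 * (b * b))
                      ≡ 6 * (5 * (b * b * b + b * (b * b) + c₂ * b + c₃)) + 30 * (b * b)
  collect = solve-∀

13*n^n≤5*[1+n]^n : ∀ n → 15 ≤ n → 13 * n ^ n ≤ 5 * suc n ^ n
13*n^n≤5*[1+n]^n n@(suc _) 15≤n = *-cancelʳ-≤ _ _ (n * n * n) (begin
  13 * n ^ n * (n * n * n)                                      ≡⟨ swap (n ^ n) (n * n * n) ⟩
  n ^ n * (13 * (n * n * n))                                    ≤⟨ *-monoʳ-≤ (n ^ n) (cubic-≤ n 15≤n) ⟩
  n ^ n * (5 * (n * n * n + n * (n * n) + (n C 2) * n + n C 3))  ≡⟨ swap′ (n ^ n) _ ⟩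
  5 * (n ^ n * (n * n * n + n * (n * n) + (n C 2) * n + n C 3))  ≤⟨ *-monoʳ-≤ 5 (truncatedBinomial-≤ n n) ⟩
  5 * (suc n ^ n * (n * n * n))                                 ≡⟨ *-assoc 5 (suc n ^ n) (n * n * n) ⟨
  5 * suc n ^ n * (n * n * n)                                   ∎)
  where
  open ≤-Reasoning
  swap : ∀ u v → 13 * u * v ≡ u * (13 * v)
  swap = solve-∀
  swap′ : ∀ u v → u * (5 * v) ≡ 5 * (u * v)
  swap′ = solve-∀

-- Large n

169*[1+k]*k^k≤25*[2+k]^[1+k] : ∀ k → 15 ≤ k → 169 * suc k * k ^ k ≤ 25 * suc (suc k) * suc (suc k) ^ k
169*[1+k]*k^k≤25*[2+k]^[1+k] k 15≤k = *-cancelˡ-≤ (suc k ^ k) {{m^n≢0 (suc k) k}} (begin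
  suc k ^ k * (169 * suc k * k ^ k)                  ≡⟨ split (suc k ^ k) (suc k) (k ^ k) ⟩
  (13 * k ^ k) * (13 * suc k ^ suc k)
    ≤⟨ *-mono-≤ (13*n^n≤5*[1+n]^n k 15≤k) (13*n^n≤5*[1+n]^n (suc k) (m≤n⇒m≤1+n 15≤k)) ⟩
  (5 * suc k ^ k) * (5 * suc (suc k) ^ suc k)        ≡⟨ join (suc k ^ k) (suc (suc k)) (suc (suc k) ^ k) ⟩
  suc k ^ k * (25 * suc (suc k) * suc (suc k) ^ k)   ∎)
  where
  open ≤-Reasoning
  split : ∀ q a u → q * (169 * a * u) ≡ (13 * u) * (13 * (a * q))
  split = solve-∀
  join : ∀ q c s → (5 * q) * (5 * (c * s)) ≡ q * (25 * c * s)
  join = solve-∀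

^12-ratio-≤ : ∀ T x y {a c u v} .{{_ : NonZero x}} → T * y ^ 12 ≤ x ^ 12 → a ≤ c → x * a * u ≤ y * c * v →
               T * u ^ 12 * (a * a) ^ 9 ≤ v ^ 12 * (c * c) ^ 9
^12-ratio-≤ T x y {a} {c} {u} {v} Ty¹²≤x¹² a≤c xau≤ycv = *-cancelˡ-≤ (x ^ 12) {{m^n≢0 x 12}} (begin
  x ^ 12 * (T * u ^ 12 * (a * a) ^ 9)   ≡⟨ solve 4 (λ T x a u → x :^ 12 :* (T :* u :^ 12 :* (a :* a) :^ 9)
                                                        := T :* a :^ 6 :* (x :* a :* u) :^ 12) refl T x a u ⟩
  T * a ^ 6 * (x * a * u) ^ 12          ≤⟨ *-monoʳ-≤ (T * a ^ 6) (^-monoˡ-≤ 12 xau≤ycv) ⟩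
  T * a ^ 6 * (y * c * v) ^ 12          ≡⟨ solve 5 (λ T y a c v → T :* a :^ 6 :* (y :* c :* v) :^ 12
                                                        := T :* y :^ 12 :* a :^ 6 :* (c :^ 12 :* v :^ 12)) refl T y a c v ⟩
  T * y ^ 12 * a ^ 6 * (c ^ 12 * v ^ 12)
    ≤⟨ *-monoˡ-≤ (c ^ 12 * v ^ 12) (*-mono-≤ Ty¹²≤x¹² (^-monoˡ-≤ 6 a≤c)) ⟩
  x ^ 12 * c ^ 6 * (c ^ 12 * v ^ 12)     ≡⟨ solve 3 (λ x c v → x :^ 12 :* c :^ 6 :* (c :^ 12 :* v :^ 12)
                                                        := x :^ 12 :* (v :^ 12 :* (c :* c) :^ 9)) refl x c v ⟩
  x ^ 12 * (v ^ 12 * (c * c) ^ 9)        ∎)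
  where open ≤-Reasoning

-- For T = 2^32 and B = 2^30 this is 2^s ≤ p^12 · B · n^9 at s = 32(k + 2) and n = (k + 1)², with p
-- replaced by its lower bound ((k + 1)k)^k / (k!(k + 1)!) and the denominator cleared.
Estimate : ℕ → ℕ → ℕ → Set
Estimate T B k = T ^ (k + 2) * (k ! * suc k !) ^ 12 ≤ (suc k ^ k * k ^ k) ^ 12 * B * (suc k * suc k) ^ 9

-- From k to k + 1, the right side of Estimate divided by (k!(k + 1)!)^12 grows at least by the factor T.
Ratio : ℕ → ℕ → Set
Ratio T k = T * (k ^ k) ^ 12 * (suc k * suc k) ^ 9 ≤ (suc (suc k) ^ k) ^ 12 * (suc (suc k) * suc (suc k)) ^ 9

Estimate-suc : ∀ T B k → Ratio T k → Estimate T B k → Estimate T B (suc k)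
Estimate-suc T B k ratio estimate = begin
  T * t * (a * f * (c * (a * f))) ^ 12          ≡⟨ solve 5 (λ T t a c f → T :* t :* (a :* f :* (c :* (a :* f))) :^ 12
                                                      := (a :* c) :^ 12 :* T :* (t :* (f :* (a :* f)) :^ 12)) refl T t a c f ⟩
  (a * c) ^ 12 * T * (t * (f * (a * f)) ^ 12)   ≤⟨ *-monoʳ-≤ ((a * c) ^ 12 * T) estimate ⟩
  (a * c) ^ 12 * T * ((q * u) ^ 12 * B * (a * a) ^ 9)
    ≡⟨ solve 6 (λ T B a c q u → (a :* c) :^ 12 :* T :* ((q :* u) :^ 12 :* B :* (a :* a) :^ 9)
                 := (a :* c :* q) :^ 12 :* B :* (T :* u :^ 12 :* (a :* a) :^ 9)) refl T B a c q u ⟩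
  (a * c * q) ^ 12 * B * (T * u ^ 12 * (a * a) ^ 9)  ≤⟨ *-monoʳ-≤ ((a * c * q) ^ 12 * B) ratio ⟩
  (a * c * q) ^ 12 * B * (v ^ 12 * (c * c) ^ 9)
    ≡⟨ solve 5 (λ B a c q v → (a :* c :* q) :^ 12 :* B :* (v :^ 12 :* (c :* c) :^ 9)
                 := (c :* v :* (a :* q)) :^ 12 :* B :* (c :* c) :^ 9) refl B a c q v ⟩
  (c * v * (a * q)) ^ 12 * B * (c * c) ^ 9       ∎
  where
  open ≤-Reasoning
  a c f q u v t : ℕ
  a = suc k
  c = suc (suc k)
  f = k !
  q = suc k ^ k
  u = k ^ k
  v = suc (suc k) ^ k
  t = T ^ (k + 2)

Ratio-≥15 : ∀ k → 15 ≤ k → Ratio (2 ^ 32) k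
Ratio-≥15 k 15≤k = ^12-ratio-≤ (2 ^ 32) 169 25 {suc k} {suc (suc k)} {k ^ k} {suc (suc k) ^ k}
  (≤ᵇ⇒≤ _ _ _) (n≤1+n _) (169*[1+k]*k^k≤25*[2+k]^[1+k] k 15≤k)

Estimate-base : Estimate (2 ^ 32) (2 ^ 30) 31
Estimate-base = ≤ᵇ⇒≤ _ _ _

Estimate-≥31 : ∀ {k} → 31 ≤′ k → Estimate (2 ^ 32) (2 ^ 30) k
Estimate-≥31 ≤′-refl = Estimate-base
Estimate-≥31 {suc k} (≤′-step 31≤′k) =
  Estimate-suc (2 ^ 32) (2 ^ 30) k (Ratio-≥15 k (≤-trans (≤ᵇ⇒≤ 15 31 _) (≤′⇒≤ 31≤′k)))
    (Estimate-≥31 31≤′k)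

p-lowerBound : ∀ {n k} → suc k * suc k ≤ n → suc k ^ k * k ^ k ≤ k ! * suc k ! * p n
p-lowerBound {n} {k} [1+k]²≤n = begin
  suc k ^ k * k ^ k                            ≡⟨ ^-distrib-* (suc k) k k ⟨
  (suc k * k) ^ k                              ≤⟨ ^-monoˡ-≤ k [1+k]k≤n∸k ⟩
  (n ∸ k) ^ k                                  ≤⟨ [n∸k]^k≤k!*[1+k]!*#partitionsInto k<n ⟩
  k ! * suc k ! * #partitionsInto n n (suc k)  ≤⟨ *-monoʳ-≤ (k ! * suc k !) (#partitionsInto≤p n (suc k)) ⟩
  k ! * suc k ! * p n                          ∎
  where
  open ≤-Reasoning
  [1+k]k+[1+k]≤n : suc k * k + suc k ≤ n
  [1+k]k+[1+k]≤n = subst (_≤ n) (trans (*-suc (suc k) k) (+-comm (suc k) (suc k * k))) [1+k]²≤n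
  k<n : k < n
  k<n = m+n≤o⇒n≤o (suc k * k) [1+k]k+[1+k]≤n
  [1+k]k≤n∸k : suc k * k ≤ n ∸ k
  [1+k]k≤n∸k = m+n≤o⇒m≤o∸n (suc k * k) (≤-trans (+-monoʳ-≤ (suc k * k) (n≤1+n k)) [1+k]k+[1+k]≤n)

Estimate⇒power-≤ : ∀ {T B k n P} → Estimate T B k → suc k ^ k * k ^ k ≤ k ! * suc k ! * P → suc k * suc k ≤ n →
                   T ^ (k + 2) ≤ P ^ 12 * B * n ^ 9
Estimate⇒power-≤ {T} {B} {k} {n} {P} estimate lower [1+k]²≤n =
  *-cancelˡ-≤ (F ^ 12) {{m^n≢0 F 12 {{k !* suc k !≢0}}}} (begin
    F ^ 12 * T ^ (k + 2)                 ≡⟨ *-comm (F ^ 12) (T ^ (k + 2)) ⟩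
    T ^ (k + 2) * F ^ 12                 ≤⟨ estimate ⟩
    (suc k ^ k * k ^ k) ^ 12 * B * (suc k * suc k) ^ 9
      ≤⟨ *-mono-≤ (*-monoˡ-≤ B (^-monoˡ-≤ 12 lower)) (^-monoˡ-≤ 9 [1+k]²≤n) ⟩
    (F * P) ^ 12 * B * n ^ 9             ≡⟨ cong (λ x → x * B * n ^ 9) (^-distrib-* F P 12) ⟩
    F ^ 12 * P ^ 12 * B * n ^ 9          ≡⟨ regroup (F ^ 12) (P ^ 12) B (n ^ 9) ⟩
    F ^ 12 * (P ^ 12 * B * n ^ 9)        ∎)
  where
  open ≤-Reasoning
  F : ℕ
  F = k ! * suc k !
  regroup : ∀ f p b m → f * p * b * m ≡ f * (p * b * m)
  regroup = solve-∀

admissible-between-squares : ∀ {n k} → 31 ≤ k → suc k * suc k ≤ n → n < suc (suc k) * suc (suc k) →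
                             Admissible n (32 * (k + 2))
admissible-between-squares {n} {k} 31≤k lower upper = square , power
  where
  square : 1024 * n ≤ 32 * (k + 2) * (32 * (k + 2))
  square = ≤-trans (*-monoʳ-≤ 1024 (<⇒≤ upper)) (≤-reflexive (identity k))
    where
    identity : ∀ k → 1024 * (suc (suc k) * suc (suc k)) ≡ 32 * (k + 2) * (32 * (k + 2))
    identity = solve-∀
  power : 2 ^ (32 * (k + 2)) ≤ p n ^ 12 * 2 ^ 30 * n ^ 9
  power = subst (_≤ p n ^ 12 * 2 ^ 30 * n ^ 9) (^-*-assoc 2 32 (k + 2))
    (Estimate⇒power-≤ {2 ^ 32} {2 ^ 30} {k} {n} {p n}
      (Estimate-≥31 (≤⇒≤′ 31≤k)) (p-lowerBound {n} {k} lower) lower)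

admissible-≥1024 : ∀ n → 1024 ≤ n → ∃ (Admissible n)
admissible-≥1024 n 1024≤n with floorSqrt n
... | j , j²≤n , n<[1+j]² = from-root j (≮⇒≥ j≮32) j²≤n n<[1+j]²
  where
  j≮32 : ¬ j < 32
  j≮32 j<32 = <⇒≱ (<-≤-trans n<[1+j]² (*-mono-≤ j<32 j<32)) 1024≤n
  from-root : ∀ j → 32 ≤ j → j * j ≤ n → n < suc j * suc j → ∃ (Admissible n)
  from-root (suc k) (s≤s 31≤k) lower upper = 32 * (k + 2) , admissible-between-squares 31≤k lower upper

admissible : ∀ n → 2 ≤ n → ∃ (Admissible n)
admissible n 2≤n with n <? 1024
... | yes n<1024 = admissible-<1024 n 2≤n n<1024
... | no n≮1024 = admissible-≥1024 n (≮⇒≥ n≮1024)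

mainTheorem3 : (n : ℕ) → 2 ≤ n → (k q : ℕ) → k * k ≤ 1024 * n * (q * q) →
    2 ^ k ≤ (p n ^ 12 * 2 ^ 30 * n ^ 9) ^ q
mainTheorem3 n 2≤n k q k²≤1024nq² with admissible n 2≤n
... | s , 1024n≤s² , 2^s≤X = begin
  2 ^ k                              ≤⟨ ^-monoʳ-≤ 2 k≤sq ⟩
  2 ^ (s * q)                        ≡⟨ ^-*-assoc 2 s q ⟨
  (2 ^ s) ^ q                        ≤⟨ ^-monoˡ-≤ q 2^s≤X ⟩
  (p n ^ 12 * 2 ^ 30 * n ^ 9) ^ q   ∎
  where
  open ≤-Reasoning
  k≤sq : k ≤ s * q
  k≤sq = m*m≤n*n⇒m≤n (begin
    k * k               ≤⟨ k²≤1024nq² ⟩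
    1024 * n * (q * q)  ≤⟨ *-monoˡ-≤ (q * q) 1024n≤s² ⟩
    s * s * (q * q)     ≡⟨ [m*n]*[o*p]≡[m*o]*[n*p] s s q q ⟩
    s * q * (s * q)     ∎)
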